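{- Let $m,n\ge 3$ and let $S$ be a self-identifying code of $K_m\times C_n$. Then for every integer $j$ (indices taken modulo $n$), \[ |(C_{j-1}\cup C_j\cup C_{j+1})\cap S|\ge m+2. \]
   Context: For a vertex $v$, $N[v]$ is its closed neighborhood. A nonempty set $S\subseteq V(G)$ is a self-identifying code of $G$ if for every vertex $v\in V(G)$: (1) $N[v]\cap S\neq\emptyset$, and (2) $\bigcap_{c\in N[v]\cap S}N[c]=\{v\}$. With $V(K_m)=\{v_0,\dots,v_{m-1}\}$ and $V(C_n)=\{0,\dots,n-1\}$ (consecutively numbered cycle), $K_m\times C_n$ has vertices $(v_i,j)$, with $(v_i,j)$ adjacent to $(v_{i'},j')$ iff $i\neq i'$ and $j-j'\equiv\pm1\pmod n$. The $j$-th column is $C_j=\{(v_i,j):0\le i\le m-1\}$, with $j$ taken modulo $n$. -}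

module Defs where

open import Data.Nat using (ℕ; zero; suc; _≟_)
open import Data.Fin using (Fin; toℕ)
open import Data.Fin.Properties using () renaming (_≟_ to _≟ᶠ_)
open import Data.Product using (_×_; _,_; Σ; ∃)
open import Data.Sum using (_⊎_)
open import Data.Bool using (Bool; true; false; if_then_else_)
open import Data.List using (List; length; filter; cartesianProduct; allFin)
open import Relation.Binary.PropositionalEquality using (_≡_)
open import Relation.Nullary using (¬_; Dec; yes; no)
open import Relation.Nullary.Decidable using (_⊎-dec_; _×-dec_)
open import Function using (_⇔_)

nextMod : ℕ → ℕ → ℕ
nextMod n x with suc x ≟ n
... | yes _ = 0
... | no  _ = suc x

_isNextOf_ : ∀ {n} → Fin n → Fin n → Set
_isNextOf_ {n} j' j = toℕ j' ≡ nextMod n (toℕ j)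

Vertex : ℕ → ℕ → Set
Vertex m n = Fin m × Fin n

Adj : ∀ {m n} → Vertex m n → Vertex m n → Set
Adj (i , j) (i' , j') = ¬ (i ≡ i') × (j' isNextOf j ⊎ j isNextOf j')

InN : ∀ {m n} → Vertex m n → Vertex m n → Set
InN v w = w ≡ v ⊎ Adj v w

VSet : ℕ → ℕ → Set
VSet m n = Vertex m n → Bool

_∈S_ : ∀ {m n} → Vertex m n → VSet m n → Set
v ∈S S = S v ≡ true

IsSelfIdentifyingCode : ∀ m n → VSet m n → Set
IsSelfIdentifyingCode m n S =
  (∃ λ (c : Vertex m n) → c ∈S S)
  × (∀ (v : Vertex m n) →
       (∃ λ c → InN v c × c ∈S S)
     × (∀ (w : Vertex m n) →
          ((∀ c → InN v c → c ∈S S → InN c w) ⇔ (w ≡ v))))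

allVertices : ∀ m n → List (Vertex m n)
allVertices m n = cartesianProduct (allFin m) (allFin n)

NearCol : ∀ {n} → Fin n → Fin n → Set
NearCol j j' = j isNextOf j' ⊎ (j' ≡ j ⊎ j' isNextOf j)

nearCol? : ∀ {n} (j j' : Fin n) → Dec (NearCol j j')
nearCol? {n} j j' =
  (toℕ j ≟ nextMod n (toℕ j')) ⊎-dec ((j' ≟ᶠ j) ⊎-dec (toℕ j' ≟ nextMod n (toℕ j)))

inS? : ∀ {m n} (S : VSet m n) (v : Vertex m n) → Dec (v ∈S S)
inS? S v = Data.Bool._≟_ (S v) true

countNear : ∀ {m n} → VSet m n → Fin n → ℕ
countNear {m} {n} S j =
  length (filter (λ v → nearCol? j (Data.Product.proj₂ v) ×-dec inS? S v) (allVertices m n))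

-- Every vertex v has two distinct code vertices among its neighbours: otherwise the code vertices
-- of N[v] would all be adjacent to a second vertex (a neighbour of v, or the unique code neighbour
-- itself). A code vertex missing from column j forces every other row to meet S in column j-1 or
-- j+1; and if the code vertices of column j all lie in one row t, then (t, j-1) and (t, j+1) are
-- code vertices, since otherwise (t, j±1) and (t, j±3) would not be separated. Counting
-- explicit duplicate-free lists of code vertices in columns j-1, j, j+1 in each case of this
-- analysis gives m + 2 of them.
module Submission where

open import Defs
open import Data.Nat using (ℕ; zero; suc; _+_; _≤_; _<_; z≤n; s≤s; _≟_)
open import Data.Nat.Properties using (≤∧≢⇒<; ≤-trans; ≤-reflexive; <-irrefl; <-trans; n<1+n; n≤1+n; suc-injective; +-comm)
open import Data.Fin using (Fin; toℕ; fromℕ<; punchIn) renaming (zero to fzero; suc to fsuc)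
open import Data.Fin.Properties using (toℕ-injective; toℕ<n; toℕ-fromℕ<; punchIn-injective; punchInᵢ≢i; any?; all?; ¬∀⟶∃¬) renaming (_≟_ to _≟ᶠ_)
open import Data.Product using (_×_; _,_; ∃; proj₁; proj₂)
open import Data.Product.Properties using (≡-dec)
open import Data.Sum using (_⊎_; inj₁; inj₂)
open import Data.List using (List; []; _∷_; length; map; allFin)
open import Data.List.Properties using (length-map; length-tabulate)
open import Data.List.Membership.Propositional using (_∈_)
open import Data.List.Membership.Propositional.Properties using (∈-filter⁺; ∈-cartesianProduct⁺; ∈-allFin)
open import Data.List.Relation.Binary.Subset.Propositional using (_⊆_)
open import Data.List.Relation.Unary.Any using (here; there)
open import Data.List.Relation.Unary.All as All using (All; _∷_; universal)
open import Data.List.Relation.Unary.All.Properties using (map⁺)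
open import Data.List.Relation.Unary.AllPairs using (_∷_)
open import Data.List.Relation.Unary.Unique.Propositional using (Unique)
import Data.List.Relation.Unary.Unique.Propositional.Properties as Unique
open import Data.Empty using (⊥-elim)
open import Function using (_∘_; Equivalence)
open import Relation.Binary.PropositionalEquality using (_≡_; _≢_; refl; sym; trans; cong)
open import Relation.Nullary using (¬_; Dec; yes; no)
open import Relation.Nullary.Decidable using (_⊎-dec_; _×-dec_; ¬?)

module _ {A : Set} where

  remove : ∀ {x : A} xs → x ∈ xs → List A
  remove (_ ∷ xs) (here _)  = xs
  remove (y ∷ xs) (there p) = y ∷ remove xs p

  length-remove : ∀ {x : A} xs (p : x ∈ xs) → length xs ≡ suc (length (remove xs p))
  length-remove (_ ∷ _)  (here _)  = refl
  length-remove (_ ∷ xs) (there p) = cong suc (length-remove xs p)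

  ∈-remove : ∀ {x y : A} {xs} (p : x ∈ xs) → y ∈ xs → y ≢ x → y ∈ remove xs p
  ∈-remove (here refl) (here refl) y≢x = ⊥-elim (y≢x refl)
  ∈-remove (here _)    (there q)   _   = q
  ∈-remove (there _)   (here refl) _   = here refl
  ∈-remove (there p)   (there q)   y≢x = there (∈-remove p q y≢x)

  unique-⊆⇒length≤ : ∀ {xs ys : List A} → Unique xs → xs ⊆ ys → length xs ≤ length ys
  unique-⊆⇒length≤ {[]}              _            _   = z≤n
  unique-⊆⇒length≤ {x ∷ xs} {ys} (x∉xs ∷ u) xs⊆ys =
    ≤-trans (s≤s (unique-⊆⇒length≤ u xs⊆ys-x)) (≤-reflexive (sym (length-remove ys x∈ys)))
    where
      x∈ys : x ∈ ys
      x∈ys = xs⊆ys (here refl)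
      xs⊆ys-x : xs ⊆ remove ys x∈ys
      xs⊆ys-x y∈xs = ∈-remove x∈ys (xs⊆ys (there y∈xs)) (λ y≡x → All.lookup x∉xs y∈xs (sym y≡x))

nextMod-< : ∀ {n x} → x < n → nextMod n x < n
nextMod-< {n} {x} x<n with suc x ≟ n
... | yes _      = ≤-trans (s≤s z≤n) x<n
... | no 1+x≢n = ≤∧≢⇒< x<n 1+x≢n

nextMod-injective : ∀ {n x y} → nextMod n x ≡ nextMod n y → x ≡ y
nextMod-injective {n} {x} {y} eq with suc x ≟ n | suc y ≟ n
... | yes 1+x≡n | yes 1+y≡n = suc-injective (trans 1+x≡n (sym 1+y≡n))
... | no _      | no _      = suc-injective eq
... | yes _     | no _      with () ← eq
... | no _      | yes _     with () ← eq

nextMod-of-< : ∀ {n x} → suc x < n → nextMod n x ≡ suc x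
nextMod-of-< {n} {x} 1+x<n with suc x ≟ n
... | yes refl = ⊥-elim (<-irrefl refl 1+x<n)
... | no _     = refl

nextMod-last : ∀ n → nextMod (suc n) n ≡ 0
nextMod-last n with suc n ≟ suc n
... | yes _  = refl
... | no 1+n≢1+n = ⊥-elim (1+n≢1+n refl)

nextMod-surjective : ∀ {n y} → y < n → ∃ λ x → x < n × nextMod n x ≡ y
nextMod-surjective {suc n} {zero}  _     = n , n<1+n n , nextMod-last n
nextMod-surjective {n}     {suc y} 1+y<n = y , <-trans (n<1+n y) 1+y<n , nextMod-of-< 1+y<n

nextMod-≢ : ∀ {n x} → 2 ≤ n → nextMod n x ≢ x
nextMod-≢ {n} {x} 2≤n eq with suc x ≟ n
nextMod-≢ (s≤s ()) refl | yes refl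
nextMod-≢ _        ()   | no _

nextMod²-≢ : ∀ {n x} → 3 ≤ n → nextMod n (nextMod n x) ≢ x
nextMod²-≢ {n} {x} 3≤n eq with suc x ≟ n
nextMod²-≢ {n} {x} 3≤n eq | yes 1+x≡n with 1 ≟ n
nextMod²-≢ (s≤s ())        _    | yes refl | yes refl
nextMod²-≢ (s≤s (s≤s ()))  refl | yes refl | no _
nextMod²-≢ {n} {x} 3≤n eq | no _ with suc (suc x) ≟ n
nextMod²-≢ (s≤s (s≤s ())) refl | no _ | yes refl
nextMod²-≢ _              ()   | no _ | no _

module Cycle {n : ℕ} where

  ColAdj : Fin n → Fin n → Set
  ColAdj y y′ = y′ isNextOf y ⊎ y isNextOf y′

  ColAdj-sym : ∀ {y y′} → ColAdj y y′ → ColAdj y′ y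
  ColAdj-sym (inj₁ e) = inj₂ e
  ColAdj-sym (inj₂ e) = inj₁ e

  colAdj? : (y y′ : Fin n) → Dec (ColAdj y y′)
  colAdj? y y′ = (toℕ y′ ≟ nextMod n (toℕ y)) ⊎-dec (toℕ y ≟ nextMod n (toℕ y′))

  next : Fin n → Fin n
  next y = fromℕ< (nextMod-< (toℕ<n y))

  next-isNextOf : ∀ y → next y isNextOf y
  next-isNextOf y = toℕ-fromℕ< _

  isNextOf⇒≡next : ∀ {y′ y} → y′ isNextOf y → y′ ≡ next y
  isNextOf⇒≡next {y = y} e = toℕ-injective (trans e (sym (next-isNextOf y)))

  next-injective : ∀ {y y′} → next y ≡ next y′ → y ≡ y′
  next-injective {y} {y′} e = toℕ-injective (nextMod-injective
    (trans (sym (next-isNextOf y)) (trans (cong toℕ e) (next-isNextOf y′))))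

  prev : Fin n → Fin n
  prev y = fromℕ< (proj₁ (proj₂ (nextMod-surjective (toℕ<n y))))

  next-prev : ∀ y → next (prev y) ≡ y
  next-prev y = sym (isNextOf⇒≡next (trans (sym (proj₂ (proj₂ surj))) (sym (cong (nextMod n) (toℕ-fromℕ< _)))))
    where surj = nextMod-surjective (toℕ<n y)

  prev-next : ∀ y → prev (next y) ≡ y
  prev-next y = next-injective (next-prev (next y))

  ColAdj-next : ∀ y → ColAdj y (next y)
  ColAdj-next y = inj₁ (next-isNextOf y)

  ColAdj-prev : ∀ y → ColAdj y (prev y)
  ColAdj-prev y = ColAdj-sym (subst-next (next-prev y))
    where
      subst-next : ∀ {y′} → next y′ ≡ y → ColAdj y′ y
      subst-next refl = ColAdj-next _

  ColAdj⇒next⊎prev : ∀ {y y′} → ColAdj y y′ → y′ ≡ next y ⊎ y′ ≡ prev y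
  ColAdj⇒next⊎prev       (inj₁ e) = inj₁ (isNextOf⇒≡next e)
  ColAdj⇒next⊎prev {y} (inj₂ e) = inj₂ (next-injective (trans (sym (isNextOf⇒≡next e)) (sym (next-prev y))))

  next-≢ : 2 ≤ n → ∀ y → next y ≢ y
  next-≢ 2≤n y e = nextMod-≢ 2≤n (trans (sym (next-isNextOf y)) (cong toℕ e))

  next²-≢ : 3 ≤ n → ∀ y → next (next y) ≢ y
  next²-≢ 3≤n y e = nextMod²-≢ 3≤n
    (trans (sym (trans (next-isNextOf (next y)) (cong (nextMod n) (next-isNextOf y)))) (cong toℕ e))

  prev-≢ : 2 ≤ n → ∀ y → prev y ≢ y
  prev-≢ 2≤n y e = next-≢ 2≤n y (trans (cong next (sym e)) (next-prev y))

  prev≢next : 3 ≤ n → ∀ y → prev y ≢ next y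
  prev≢next 3≤n y e = next²-≢ 3≤n y (trans (cong next (sym e)) (next-prev y))

  prev²-≢ : 3 ≤ n → ∀ y → prev (prev y) ≢ y
  prev²-≢ 3≤n y e = prev≢next 3≤n (prev y) (trans e (sym (next-prev y)))

  ColAdj-irrefl : 2 ≤ n → ∀ {y y′} → ColAdj y y′ → y′ ≢ y
  ColAdj-irrefl 2≤n {y} adj with ColAdj⇒next⊎prev adj
  ... | inj₁ refl = next-≢ 2≤n y
  ... | inj₂ refl = prev-≢ 2≤n y

open Cycle

-- Rows are Fin (2 + k): the argument needs only m ≥ 2.
module SelfIdentifyingCodeOn (k : ℕ) {n : ℕ} (3≤n : 3 ≤ n) (S : VSet (2 + k) n)
                             (code : IsSelfIdentifyingCode (2 + k) n S) where

  m : ℕ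
  m = 2 + k

  Row : Set
  Row = Fin m

  V : Set
  V = Vertex m n

  2≤n : 2 ≤ n
  2≤n = ≤-trans (n≤1+n 2) 3≤n

  anotherRow : (i : Row) → ∃ λ i′ → i′ ≢ i
  anotherRow fzero    = fsuc fzero , λ ()
  anotherRow (fsuc _) = fzero      , λ ()

  identifies : ∀ {v w : V} → (∀ c → InN v c → c ∈S S → InN c w) → w ≡ v
  identifies {v} {w} = Equivalence.to (proj₂ (proj₂ code v) w)

  _≟V_ : (v w : V) → Dec (v ≡ w)
  _≟V_ = ≡-dec _≟ᶠ_ _≟ᶠ_

  adj? : (v w : V) → Dec (Adj v w)
  adj? (i , y) (i′ , y′) = ¬? (i ≟ᶠ i′) ×-dec colAdj? y y′

  anyVertex? : {P : V → Set} → (∀ v → Dec (P v)) → Dec (∃ P)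
  anyVertex? P? with any? (λ i → any? (λ y → P? (i , y)))
  ... | yes (i , y , p) = yes ((i , y) , p)
  ... | no none         = no (λ { ((i , y) , p) → none (i , y , p) })

  record TwoCodeNeighbours (v : V) : Set where
    field
      c₁ c₂ : V
      adj₁  : Adj v c₁
      adj₂  : Adj v c₂
      c₁∈S  : c₁ ∈S S
      c₂∈S  : c₂ ∈S S
      c₁≢c₂ : c₁ ≢ c₂

  twoCodeNeighbours : (v : V) → TwoCodeNeighbours v
  twoCodeNeighbours v@(i , y) with anyVertex? (λ c → adj? v c ×-dec inS? S c)
  ... | no none = ⊥-elim (proj₂ (anotherRow i) (cong proj₁ (identifies coversNeighbour)))
    where
      coversNeighbour : ∀ c → InN v c → c ∈S S → InN c (proj₁ (anotherRow i) , next y)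
      coversNeighbour _ (inj₁ refl) _   = inj₂ (proj₂ (anotherRow i) ∘ sym , ColAdj-next y)
      coversNeighbour c (inj₂ adj) c∈S = ⊥-elim (none (c , adj , c∈S))
  ... | yes (c₁ , adj₁ , c₁∈S) with anyVertex? (λ c → (adj? v c ×-dec inS? S c) ×-dec ¬? (c ≟V c₁))
  ...   | yes (c₂ , (adj₂ , c₂∈S) , c₂≢c₁) = record
          { c₁ = c₁ ; c₂ = c₂ ; adj₁ = adj₁ ; adj₂ = adj₂ ; c₁∈S = c₁∈S ; c₂∈S = c₂∈S ; c₁≢c₂ = c₂≢c₁ ∘ sym }
  ...   | no none = ⊥-elim (proj₁ adj₁ (sym (cong proj₁ (identifies coversC₁))))
    where
      coversC₁ : ∀ c → InN v c → c ∈S S → InN c c₁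
      coversC₁ _ (inj₁ refl) _ = inj₂ adj₁
      coversC₁ c (inj₂ adj) c∈S with c ≟V c₁
      ... | yes c≡c₁ = inj₁ (sym c≡c₁)
      ... | no c≢c₁  = ⊥-elim (none (c , (adj , c∈S) , c≢c₁))

  CodeBeside : Fin n → Row → Set
  CodeBeside y r = ∃ λ y′ → ColAdj y y′ × (r , y′) ∈S S

  codeBeside? : ∀ y r → Dec (CodeBeside y r)
  codeBeside? y r = any? (λ y′ → colAdj? y y′ ×-dec inS? S (r , y′))

  codeBeside-of-∉ : ∀ {i r y} → ¬ (i , y) ∈S S → r ≢ i → CodeBeside y r
  codeBeside-of-∉ {i} {r} {y} i∉S r≢i with codeBeside? y r
  ... | yes beside = beside
  ... | no ¬beside = ⊥-elim (r≢i (cong proj₁ (identifies coversRow)))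
    where
      coversRow : ∀ c → InN (i , y) c → c ∈S S → InN c (r , y)
      coversRow _       (inj₁ refl)      c∈S = ⊥-elim (i∉S c∈S)
      coversRow (x , z) (inj₂ (_ , adj)) c∈S with x ≟ᶠ r
      ... | yes refl = ⊥-elim (¬beside (z , adj , c∈S))
      ... | no x≢r   = inj₂ (x≢r , ColAdj-sym adj)

  -- (t, p) is forced into S from the side of a, whose code vertices avoid row t; q lies two
  -- steps away from p through its other neighbour b.
  forcedCode : ∀ {t p a b q} → (∀ {y} → ColAdj p y → y ≡ a ⊎ y ≡ b) → ColAdj b q → q ≢ p →
               (∀ x → x ≢ t → ¬ (x , a) ∈S S) → (t , p) ∈S S
  forcedCode {t} {p} {q = q} neighbours adj-bq q≢p onlyRowT with inS? S (t , p)
  ... | yes t∈S = t∈S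
  ... | no t∉S  = ⊥-elim (q≢p (cong proj₂ (identifies coversQ)))
    where
      coversQ : ∀ c → InN (t , p) c → c ∈S S → InN c (t , q)
      coversQ _       (inj₁ refl)        c∈S = ⊥-elim (t∉S c∈S)
      coversQ (x , y) (inj₂ (t≢x , adj)) c∈S with neighbours adj
      ... | inj₁ refl = ⊥-elim (onlyRowT x (t≢x ∘ sym) c∈S)
      ... | inj₂ refl = inj₂ (t≢x ∘ sym , adj-bq)

  transversal : (Row → Fin n) → List Row → List V
  transversal σ = map (λ r → r , σ r)

  transversal-unique : ∀ {σ rs} → Unique rs → Unique (transversal σ rs)
  transversal-unique = Unique.map⁺ (cong proj₁)

  transversal-all : ∀ {P : V → Set} {σ rs} → All (λ r → P (r , σ r)) rs → All P (transversal σ rs)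
  transversal-all = map⁺

  transversal-avoidsColumn : ∀ {σ rs} {v : V} → (∀ r → σ r ≢ proj₂ v) → All (v ≢_) (transversal σ rs)
  transversal-avoidsColumn {rs = rs} σ≢ = transversal-all (universal (λ r e → σ≢ r (sym (cong proj₂ e))) rs)

  length-transversal-allFin : ∀ σ → length (transversal σ (allFin m)) ≡ m
  length-transversal-allFin σ = trans (length-map (λ r → r , σ r) (allFin m)) (length-tabulate (λ r → r))

  rowsExcept : Row → List Row
  rowsExcept i = map (punchIn i) (allFin (suc k))

  rowsExcept-unique : ∀ i → Unique (rowsExcept i)
  rowsExcept-unique i = Unique.map⁺ (punchIn-injective i _ _) (Unique.allFin⁺ (suc k))

  rowsExcept-≢ : ∀ i → All (_≢ i) (rowsExcept i)
  rowsExcept-≢ i = map⁺ (universal (punchInᵢ≢i i) (allFin (suc k)))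

  length-transversal-rowsExcept : ∀ σ i → length (transversal σ (rowsExcept i)) ≡ suc k
  length-transversal-rowsExcept σ i = trans (length-map (λ r → r , σ r) (rowsExcept i))
    (trans (length-map (punchIn i) (allFin (suc k))) (length-tabulate (λ r → r)))

  transversal-avoidsRow : ∀ {σ i y} → All ((i , y) ≢_) (transversal σ (rowsExcept i))
  transversal-avoidsRow {i = i} = transversal-all (All.map (λ r≢i e → r≢i (sym (cong proj₁ e))) (rowsExcept-≢ i))

  module Window (j : Fin n) where

    j+1 j-1 : Fin n
    j+1 = next j
    j-1 = prev j

    Counted : V → Set
    Counted v = NearCol j (proj₂ v) × v ∈S S

    ∈-allVertices : (v : V) → v ∈ allVertices m n
    ∈-allVertices (i , y) = ∈-cartesianProduct⁺ (∈-allFin i) (∈-allFin y)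

    countNear-≥ : ∀ (ws : List V) → Unique ws → All Counted ws → length ws ≡ 2 + m → 2 + m ≤ countNear S j
    countNear-≥ ws u counted len = ≤-trans (≤-reflexive (sym len)) (unique-⊆⇒length≤ u ws⊆counted)
      where
        ws⊆counted : ws ⊆ _
        ws⊆counted {v} v∈ws = ∈-filter⁺ (λ v → nearCol? j (proj₂ v) ×-dec inS? S v)
                                         (∈-allVertices v) (All.lookup counted v∈ws)

    counted-centre : ∀ {r} → (r , j) ∈S S → Counted (r , j)
    counted-centre r∈S = inj₂ (inj₁ refl) , r∈S

    counted-beside : ∀ {v} → ColAdj j (proj₂ v) → v ∈S S → Counted v
    counted-beside (inj₁ e) v∈S = inj₂ (inj₂ e) , v∈S
    counted-beside (inj₂ e) v∈S = inj₁ e , v∈S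

    counted-neighbour : ∀ {i c} → Adj (i , j) c → c ∈S S → Counted c
    counted-neighbour adj = counted-beside (proj₂ adj)

    offCentre : ∀ {i c rs} → Adj (i , j) c → All (c ≢_) (transversal (λ _ → j) rs)
    offCentre adj = transversal-avoidsColumn (λ _ e → ColAdj-irrefl 2≤n (proj₂ adj) (sym e))

    forcedCode-j+1 : ∀ {t} → (∀ x → x ≢ t → ¬ (x , j) ∈S S) → (t , j+1) ∈S S
    forcedCode-j+1 = forcedCode neighbours (ColAdj-next _) (next²-≢ 3≤n j+1)
      where
        neighbours : ∀ {y} → ColAdj j+1 y → y ≡ j ⊎ y ≡ next j+1
        neighbours adj with ColAdj⇒next⊎prev adj
        ... | inj₁ e = inj₂ e
        ... | inj₂ e = inj₁ (trans e (prev-next j))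

    forcedCode-j-1 : ∀ {t} → (∀ x → x ≢ t → ¬ (x , j) ∈S S) → (t , j-1) ∈S S
    forcedCode-j-1 = forcedCode neighbours (ColAdj-prev _) (prev²-≢ 3≤n j-1)
      where
        neighbours : ∀ {y} → ColAdj j-1 y → y ≡ j ⊎ y ≡ prev j-1
        neighbours adj with ColAdj⇒next⊎prev adj
        ... | inj₁ e = inj₁ (trans e (next-prev j))
        ... | inj₂ e = inj₂ e

    bound-fullCentre : (∀ r → (r , j) ∈S S) → 2 + m ≤ countNear S j
    bound-fullCentre centre =
      countNear-≥ ws unique counted (cong (2 +_) (length-transversal-allFin (λ _ → j)))
      where
        open TwoCodeNeighbours (twoCodeNeighbours (fzero , j))
        ws : List V
        ws = c₁ ∷ c₂ ∷ transversal (λ _ → j) (allFin m)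
        unique : Unique ws
        unique = (c₁≢c₂ ∷ offCentre adj₁) ∷ offCentre adj₂ ∷ transversal-unique (Unique.allFin⁺ m)
        counted : All Counted ws
        counted = counted-neighbour adj₁ c₁∈S ∷ counted-neighbour adj₂ c₂∈S
                ∷ transversal-all (universal (λ r → counted-centre (centre r)) _)

    bound-emptyRow : ∀ {i} → ¬ (i , j) ∈S S → ¬ CodeBeside j i → 2 + m ≤ countNear S j
    bound-emptyRow {i} i∉S ¬beside =
      countNear-≥ ws unique counted (cong (3 +_) (length-transversal-rowsExcept (λ _ → j) i))
      where
        centre : ∀ {r} → r ≢ i → (r , j) ∈S S
        centre {r} r≢i with inS? S (r , j)
        ... | yes r∈S = r∈S
        ... | no r∉S  = ⊥-elim (¬beside (codeBeside-of-∉ r∉S (r≢i ∘ sym)))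
        i′ : Row
        i′ = proj₁ (anotherRow i)
        i′≢i : i′ ≢ i
        i′≢i = proj₂ (anotherRow i)
        beside : CodeBeside j i′
        beside = codeBeside-of-∉ i∉S i′≢i
        open TwoCodeNeighbours (twoCodeNeighbours (i′ , j))
        ws : List V
        ws = c₁ ∷ c₂ ∷ (i′ , proj₁ beside) ∷ transversal (λ _ → j) (rowsExcept i)
        unique : Unique ws
        unique = (c₁≢c₂ ∷ (λ e → proj₁ adj₁ (sym (cong proj₁ e))) ∷ offCentre adj₁)
               ∷ ((λ e → proj₁ adj₂ (sym (cong proj₁ e))) ∷ offCentre adj₂)
               ∷ transversal-avoidsColumn (λ _ e → ColAdj-irrefl 2≤n (proj₁ (proj₂ beside)) (sym e))
               ∷ transversal-unique (rowsExcept-unique i)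
        counted : All Counted ws
        counted = counted-neighbour adj₁ c₁∈S ∷ counted-neighbour adj₂ c₂∈S
                ∷ counted-beside (proj₁ (proj₂ beside)) (proj₂ (proj₂ beside))
                ∷ transversal-all (All.map (counted-centre ∘ centre) (rowsExcept-≢ i))

    bound-emptyCentre : (∀ x → ¬ (x , j) ∈S S) → 2 + m ≤ countNear S j
    bound-emptyCentre empty =
      countNear-≥ ws unique counted (cong (2 +_) (length-transversal-allFin (λ _ → j-1)))
      where
        i′ : Row
        i′ = proj₁ (anotherRow fzero)
        ws : List V
        ws = (fzero , j+1) ∷ (i′ , j+1) ∷ transversal (λ _ → j-1) (allFin m)
        j-1≢j+1 : ∀ r → j-1 ≢ j+1
        j-1≢j+1 _ = prev≢next 3≤n j
        unique : Unique ws
        unique = ((proj₂ (anotherRow fzero) ∘ sym ∘ cong proj₁) ∷ transversal-avoidsColumn j-1≢j+1)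
               ∷ transversal-avoidsColumn j-1≢j+1 ∷ transversal-unique (Unique.allFin⁺ m)
        outsideRow : ∀ {t} x → x ≢ t → ¬ (x , j) ∈S S
        outsideRow x _ = empty x
        counted : All Counted ws
        counted = counted-beside (ColAdj-next j) (forcedCode-j+1 outsideRow)
                ∷ counted-beside (ColAdj-next j) (forcedCode-j+1 outsideRow)
                ∷ transversal-all (universal (λ _ → counted-beside (ColAdj-prev j) (forcedCode-j-1 outsideRow)) _)

    module _ (beside : ∀ r → CodeBeside j r) where

      σ : Row → Fin n
      σ r = proj₁ (beside r)

      counted-σ : ∀ r → Counted (r , σ r)
      counted-σ r = counted-beside (proj₁ (proj₂ (beside r))) (proj₂ (proj₂ (beside r)))

      σ≢j : ∀ r → σ r ≢ j
      σ≢j r = ColAdj-irrefl 2≤n (proj₁ (proj₂ (beside r)))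

      bound-twoInCentre : ∀ {x x′} → x ≢ x′ → (x , j) ∈S S → (x′ , j) ∈S S → 2 + m ≤ countNear S j
      bound-twoInCentre {x} {x′} x≢x′ x∈S x′∈S =
        countNear-≥ ws unique counted (cong (2 +_) (length-transversal-allFin σ))
        where
          ws : List V
          ws = (x , j) ∷ (x′ , j) ∷ transversal σ (allFin m)
          unique : Unique ws
          unique = ((x≢x′ ∘ cong proj₁) ∷ transversal-avoidsColumn σ≢j) ∷ transversal-avoidsColumn σ≢j
                 ∷ transversal-unique (Unique.allFin⁺ m)
          counted : All Counted ws
          counted = counted-centre x∈S ∷ counted-centre x′∈S ∷ transversal-all (universal counted-σ _)

      bound-oneInCentre : ∀ {x} → (x , j) ∈S S → (∀ x′ → x′ ≢ x → ¬ (x′ , j) ∈S S) → 2 + m ≤ countNear S j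
      bound-oneInCentre {x} x∈S onlyX =
        countNear-≥ ws unique counted (cong (3 +_) (length-transversal-rowsExcept σ x))
        where
          ws : List V
          ws = (x , j) ∷ (x , j-1) ∷ (x , j+1) ∷ transversal σ (rowsExcept x)
          unique : Unique ws
          unique = ((prev-≢ 2≤n j ∘ sym ∘ cong proj₂) ∷ (next-≢ 2≤n j ∘ sym ∘ cong proj₂) ∷ transversal-avoidsRow)
                 ∷ ((prev≢next 3≤n j ∘ cong proj₂) ∷ transversal-avoidsRow)
                 ∷ transversal-avoidsRow
                 ∷ transversal-unique (rowsExcept-unique x)
          counted : All Counted ws
          counted = counted-centre x∈S ∷ counted-beside (ColAdj-prev j) (forcedCode-j-1 onlyX)
                  ∷ counted-beside (ColAdj-next j) (forcedCode-j+1 onlyX)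
                  ∷ transversal-all (universal counted-σ _)

      bound-allBeside : 2 + m ≤ countNear S j
      bound-allBeside with any? (λ x → inS? S (x , j))
      ... | no none = bound-emptyCentre (λ x x∈S → none (x , x∈S))
      ... | yes (x , x∈S) with any? (λ x′ → ¬? (x′ ≟ᶠ x) ×-dec inS? S (x′ , j))
      ...   | yes (x′ , x′≢x , x′∈S) = bound-twoInCentre (x′≢x ∘ sym) x∈S x′∈S
      ...   | no none = bound-oneInCentre x∈S (λ x′ x′≢x x′∈S → none (x′ , x′≢x , x′∈S))

    bound : 2 + m ≤ countNear S j
    bound with all? (λ r → inS? S (r , j))
    ... | yes full = bound-fullCentre full
    ... | no notFull with ¬∀⟶∃¬ m _ (λ r → inS? S (r , j)) notFull
    ...   | i , i∉S with codeBeside? j i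
    ...     | no ¬beside = bound-emptyRow i∉S ¬beside
    ...     | yes beside = bound-allBeside besideEverywhere
      where
        besideEverywhere : ∀ r → CodeBeside j r
        besideEverywhere r with r ≟ᶠ i
        ... | yes refl = beside
        ... | no r≢i   = codeBeside-of-∉ i∉S r≢i

lemma14 : (m n : ℕ) → 3 ≤ m → 3 ≤ n → (S : VSet m n) → IsSelfIdentifyingCode m n S →
    (j : Fin n) → m + 2 ≤ countNear S j
lemma14 (suc zero)      _ (s≤s ()) _ _ _ _
lemma14 m@(suc (suc k)) n _ 3≤n S code j =
  ≤-trans (≤-reflexive (+-comm m 2)) (SelfIdentifyingCodeOn.Window.bound k 3≤n S code j)
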